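{- Let $n$ be a positive integer and let $\overrightarrow{C}_{2n+1}(J)$ be (isomorphic to) a composition of circulant tournaments. Then there exist simple circulant tournaments $T_1,T_2,\ldots,T_k$ such that $\overrightarrow{C}_{2n+1}(J)$ is isomorphic to the nested composition $T_1[T_2[\cdots T_{k-1}[T_k]\cdots]]$.
   Context: $\mathbb{Z}_{2q+1}$ is the group of residues modulo $2q+1$. A symbol set is $J\subseteq\mathbb{Z}_{2q+1}\setminus\{0\}$ with $|J|=q$ and $|\{j,-j\}\cap J|=1$ for all $j\in J$; the circulant tournament $\overrightarrow{C}_{2q+1}(J)$ has vertex set $\mathbb{Z}_{2q+1}$ and arcs $(i,j)$ with $j-i\in J$ ($q\ge1$). The composition $D[F]$ of digraphs replaces each vertex $v$ of $D$ by a disjoint copy $F_v$ of $F$, keeps arcs within each $F_v$, and adds all arcs from $V(F_v)$ to $V(F_w)$ whenever $(v,w)\in A(D)$. A digraph is simple if it is not isomorphic to a composition $D[F]$ with $D$ and $F$ each having at least two vertices. -}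

module Defs where

open import Data.Nat using (ℕ; zero; suc; _+_; _*_; _∸_; _≤_; NonZero)
open import Data.Nat.DivMod using (_mod_)
open import Data.Fin using (Fin; toℕ)
open import Data.Fin.Subset using (Subset; _∈_; _∉_; ∣_∣)
open import Data.Product using (Σ; ∃; ∃-syntax; _×_; _,_)
open import Data.Sum using (_⊎_)
open import Data.List using (List; []; _∷_)
open import Function.Bundles using (_↔_; _⇔_; Inverse)
open import Relation.Binary.PropositionalEquality using (_≡_; _≢_)
open import Relation.Nullary using (¬_)
open import Data.Unit.Polymorphic using (⊤)

record Digraph : Set₁ where
  field
    V   : Set
    Arc : V → V → Set
open Digraph public

_≅_ : Digraph → Digraph → Set
D ≅ E = Σ (V D ↔ V E) λ f → ∀ x y → Arc D x y ⇔ Arc E (Inverse.to f x) (Inverse.to f y)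

-- Composition D[F]: vertex (v , x) is vertex x of the copy F_v.
_[_] : Digraph → Digraph → Digraph
D [ F ] = record
  { V   = V D × V F
  ; Arc = λ { (v , x) (w , y) → (v ≡ w × Arc F x y) ⊎ (v ≢ w × Arc D v w) } }

HasTwoVertices : Digraph → Set
HasTwoVertices D = Σ (V D) λ x → Σ (V D) λ y → x ≢ y

Simple : Digraph → Set₁
Simple T = ¬ (Σ Digraph λ D → Σ Digraph λ F →
               HasTwoVertices D × HasTwoVertices F × (T ≅ (D [ F ])))

module _ (q : ℕ) where
  m : ℕ
  m = suc (2 * q)

  negZ : Fin m → Fin m
  negZ j = (m ∸ toℕ j) mod m

  subZ : Fin m → Fin m → Fin m
  subZ j i = (toℕ j + (m ∸ toℕ i)) mod m

  zeroZ : Fin m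
  zeroZ = 0 mod m

-- Symbol set J ⊆ ℤ_{2q+1} \ {0}, |J| = q, |{j,-j} ∩ J| = 1 for all j ∈ J
-- (given j ∈ J, this says: -j ∈ J only if j = -j).
IsSymbolSet : (q : ℕ) → Subset (suc (2 * q)) → Set
IsSymbolSet q J =
  zeroZ q ∉ J × ∣ J ∣ ≡ q × (∀ j → j ∈ J → negZ q j ∈ J → j ≡ negZ q j)

Circ : (q : ℕ) → Subset (suc (2 * q)) → Digraph
Circ q J = record { V = Fin (suc (2 * q)) ; Arc = λ i j → subZ q j i ∈ J }

record CircTournament : Set where
  field
    q      : ℕ
    q≥1    : 1 ≤ q
    J      : Subset (suc (2 * q))
    symbol : IsSymbolSet q J

toDigraph : CircTournament → Digraph
toDigraph T = Circ (CircTournament.q T) (CircTournament.J T)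

nest : CircTournament → List CircTournament → Digraph
nest T []        = toDigraph T
nest T (T' ∷ Ts) = toDigraph T [ nest T' Ts ]

AllSimple : List CircTournament → Set₁
AllSimple []       = ⊤
AllSimple (T ∷ Ts) = Simple (toDigraph T) × AllSimple Ts

module Submission where

-- We prove this for every circulant tournament C_{2q+1}(J).  The proof is by strong
-- induction on q.  A module is a set of vertices that every outside vertex sees
-- uniformly; the copies F_v of a composition D[F] are modules, so a circulant
-- without a nontrivial module (≥ 2 elements, not all vertices) is simple.  Otherwise
-- translate such a module to contain 0 and enlarge it to a maximal proper module K.
-- Strong connectivity of the circulant shows that K is closed under translation by
-- its own elements, hence K = dℤ for a divisor 1 < d < 2q+1, and the module property
-- makes membership in J of non-multiples of d depend only on their residue mod d.
-- This yields C_{2q+1}(J) ≅ A[B] for circulants A on ℤ_d and B on ℤ_{(2q+1)/d}, whose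
-- decompositions concatenate.

open import Defs
open import Data.Bool using (true; false)
open import Data.Empty using (⊥; ⊥-elim)
open import Data.Fin using (Fin; toℕ; cast; combine; remQuot) renaming (zero to fzero; suc to fsuc)
open import Data.Fin.Permutation using (Permutation′; permutation)
open import Data.Fin.Properties
  using (toℕ-injective; toℕ<n; toℕ-fromℕ<; toℕ-cast; cast-involutive; toℕ-combine;
         remQuot-combine; combine-remQuot; all?; any?)
  renaming (_≟_ to _≟F_)
open import Data.Fin.Subset using (Subset; _∈_; _∉_; _⊆_; _∪_; ∣_∣; ⁅_⁆; ⊤)
open import Data.Fin.Subset.Properties
  using (_∈?_; _⊂?_; anySubset?; x∈p∪q⁻; x∈p∪q⁺; p⊂q⇒∣p∣<∣q∣; ∣p∣≤n; ∣p∣≡n⇒p≡⊤; ∈⊤;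
         x∈⁅x⁆; x∈⁅y⁆⇒x≡y)
open import Data.List using (List; []; _∷_; _++_)
open import Data.Nat using (ℕ; zero; suc; _+_; _*_; _∸_; _≤_; _<_; _<?_; NonZero; _%_; _/_;
                            >-nonZero; >-nonZero⁻¹; z≤n; s≤s; s<s⁻¹)
open import Data.Nat.DivMod
  using (_mod_; %-distribˡ-+; %-congʳ; m%n%n≡m%n; n%n≡0; m*n%n≡0; m%n<n; m<n⇒m%n≡m;
         m≡m%n+[m/n]*n; m*[n/m]≡n; m∣n⇒o%n%m≡o%m; m%n*o≡m*o%[n*o])
open import Data.Nat.Divisibility using (_∣_; divides; m%n≡0⇒n∣m; n∣m⇒m%n≡0; ∣m+n∣m⇒∣n; ∣n⇒∣m*n)
open import Data.Nat.Induction using (<-rec)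
open import Data.Nat.Properties
open import Algebra.Properties.CommutativeMonoid.Sum +-0-commutativeMonoid
  using (sum; sum-permute; ∑-distrib-+)
open import Data.Nat.Tactic.RingSolver using (solve-∀)
open import Data.Product using (Σ; ∃; _×_; _,_; proj₁; proj₂; map; swap)
open import Data.Sum using (_⊎_; inj₁; inj₂; [_,_]′)
open import Data.Unit.Polymorphic using (tt)
open import Data.Vec using ([]; _∷_; lookup; tabulate)
open import Data.Vec.Properties using ([]=⇒lookup; lookup⇒[]=; lookup∘tabulate)
open import Function.Base using (_∘′_)
open import Function.Bundles using (Inverse; Equivalence; mk↔ₛ′; mk⇔)
open import Level using (0ℓ)
open import Relation.Binary.Bundles using (Setoid)
open import Relation.Binary.PropositionalEquality hiding ([_])
import Relation.Binary.Reasoning.Setoid as SetoidReasoning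
open import Relation.Nullary using (¬_; Dec; yes; no; contradiction)
open import Relation.Nullary.Decidable using (_×-dec_; _→-dec_; ¬?)

mkIso : {D E : Digraph} (to : V D → V E) (from : V E → V D) →
        (∀ y → to (from y) ≡ y) → (∀ x → from (to x) ≡ x) →
        (∀ x y → Arc D x y → Arc E (to x) (to y)) →
        (∀ x y → Arc E (to x) (to y) → Arc D x y) → D ≅ E
mkIso to from to∘from from∘to preserves reflects =
  mk↔ₛ′ to from to∘from from∘to , λ x y → mk⇔ (preserves x y) (reflects x y)

module Iso {D E : Digraph} (i : D ≅ E) where
  to : V D → V E
  to = Inverse.to (proj₁ i)

  from : V E → V D
  from = Inverse.from (proj₁ i)

  to∘from : ∀ y → to (from y) ≡ y
  to∘from = Inverse.strictlyInverseˡ (proj₁ i)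

  from∘to : ∀ x → from (to x) ≡ x
  from∘to = Inverse.strictlyInverseʳ (proj₁ i)

  arc : ∀ x y → Arc D x y → Arc E (to x) (to y)
  arc x y = Equivalence.to (proj₂ i x y)

  arc⁻ : ∀ x y → Arc E (to x) (to y) → Arc D x y
  arc⁻ x y = Equivalence.from (proj₂ i x y)

  to-injective : ∀ x y → to x ≡ to y → x ≡ y
  to-injective x y e = trans (sym (from∘to x)) (trans (cong from e) (from∘to y))

  from-injective : ∀ x y → from x ≡ from y → x ≡ y
  from-injective x y e = trans (sym (to∘from x)) (trans (cong to e) (to∘from y))

≅-refl : {D : Digraph} → D ≅ D
≅-refl {D} = mkIso {D} {D} (λ x → x) (λ x → x) (λ _ → refl) (λ _ → refl) (λ _ _ a → a) (λ _ _ a → a)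

≅-sym : {D E : Digraph} → D ≅ E → E ≅ D
≅-sym {D} {E} i = mkIso {E} {D} from to from∘to to∘from preserves reflects
  where
  open Iso {D} {E} i
  preserves : ∀ x y → Arc E x y → Arc D (from x) (from y)
  preserves x y a = arc⁻ (from x) (from y) (subst₂ (Arc E) (sym (to∘from x)) (sym (to∘from y)) a)
  reflects : ∀ x y → Arc D (from x) (from y) → Arc E x y
  reflects x y a = subst₂ (Arc E) (to∘from x) (to∘from y) (arc (from x) (from y) a)

≅-trans : {D E F : Digraph} → D ≅ E → E ≅ F → D ≅ F
≅-trans {D} {E} {F} i j = mkIso {D} {F} (J.to ∘′ I.to) (I.from ∘′ J.from)
  (λ z → trans (cong J.to (I.to∘from _)) (J.to∘from z))
  (λ x → trans (cong I.from (J.from∘to _)) (I.from∘to x))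
  (λ x y a → J.arc _ _ (I.arc x y a))
  (λ x y a → I.arc⁻ x y (J.arc⁻ _ _ a))
  where
  module I = Iso {D} {E} i
  module J = Iso {E} {F} j

[]-cong : {D D' F F' : Digraph} → D ≅ D' → F ≅ F' → (D [ F ]) ≅ (D' [ F' ])
[]-cong {D} {D'} {F} {F'} i j =
  mkIso {D [ F ]} {D' [ F' ]} (map I.to J.to) (map I.from J.from)
    (λ (v , x) → cong₂ _,_ (I.to∘from v) (J.to∘from x))
    (λ (v , x) → cong₂ _,_ (I.from∘to v) (J.from∘to x))
    preserves reflects
  where
  module I = Iso {D} {D'} i
  module J = Iso {F} {F'} j
  preserves : ∀ u w → Arc (D [ F ]) u w → Arc (D' [ F' ]) (map I.to J.to u) (map I.to J.to w)
  preserves (v , x) (w , y) (inj₁ (v≡w , a)) = inj₁ (cong I.to v≡w , J.arc x y a)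
  preserves (v , x) (w , y) (inj₂ (v≢w , a)) = inj₂ ((λ e → v≢w (I.to-injective v w e)) , I.arc v w a)
  reflects : ∀ u w → Arc (D' [ F' ]) (map I.to J.to u) (map I.to J.to w) → Arc (D [ F ]) u w
  reflects (v , x) (w , y) (inj₁ (e , a)) = inj₁ (I.to-injective v w e , J.arc⁻ x y a)
  reflects (v , x) (w , y) (inj₂ (ne , a)) = inj₂ ((λ e → ne (cong I.to e)) , I.arc⁻ v w a)

[]-assoc : {X Y Z : Digraph} → ((X [ Y ]) [ Z ]) ≅ (X [ Y [ Z ] ])
[]-assoc {X} {Y} {Z} =
  mkIso {(X [ Y ]) [ Z ]} {X [ Y [ Z ] ]} (λ ((x , y) , z) → x , (y , z)) (λ (x , (y , z)) → (x , y) , z)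
    (λ _ → refl) (λ _ → refl) preserves reflects
  where
  preserves : ∀ u w → Arc ((X [ Y ]) [ Z ]) u w → Arc (X [ Y [ Z ] ]) _ _
  preserves ((x , y) , z) ((x' , y') , z') (inj₁ (refl , a)) = inj₁ (refl , inj₁ (refl , a))
  preserves ((x , y) , z) ((x' , y') , z') (inj₂ (ne , inj₁ (refl , a))) =
    inj₁ (refl , inj₂ ((λ { refl → ne refl }) , a))
  preserves ((x , y) , z) ((x' , y') , z') (inj₂ (ne , inj₂ (x≢x' , a))) = inj₂ (x≢x' , a)
  reflects : ∀ u w → Arc (X [ Y [ Z ] ]) _ _ → Arc ((X [ Y ]) [ Z ]) u w
  reflects ((x , y) , z) ((x' , y') , z') (inj₁ (refl , inj₁ (refl , a))) = inj₁ (refl , a)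
  reflects ((x , y) , z) ((x' , y') , z') (inj₁ (refl , inj₂ (y≢y' , a))) =
    inj₂ ((λ { refl → y≢y' refl }) , inj₁ (refl , a))
  reflects ((x , y) , z) ((x' , y') , z') (inj₂ (x≢x' , a)) =
    inj₂ ((λ { refl → x≢x' refl }) , inj₂ (x≢x' , a))

nest-++ : ∀ A As B Bs → (nest A As [ nest B Bs ]) ≅ nest A (As ++ B ∷ Bs)
nest-++ A []        B Bs = ≅-refl {toDigraph A [ nest B Bs ]}
nest-++ A (A' ∷ As) B Bs =
  ≅-trans {(toDigraph A [ nest A' As ]) [ nest B Bs ]} {toDigraph A [ nest A' As [ nest B Bs ] ]}
          {nest A (A' ∷ As ++ B ∷ Bs)}
    ([]-assoc {toDigraph A} {nest A' As} {nest B Bs})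
    ([]-cong {toDigraph A} {toDigraph A} {nest A' As [ nest B Bs ]} {nest A' (As ++ B ∷ Bs)}
      (≅-refl {toDigraph A}) (nest-++ A' As B Bs))

AllSimple-++ : ∀ A As B Bs → AllSimple (A ∷ As) → AllSimple (B ∷ Bs) → AllSimple (A ∷ (As ++ B ∷ Bs))
AllSimple-++ A []        B Bs (sA , _)    sB = sA , sB
AllSimple-++ A (A' ∷ As) B Bs (sA , sAs) sB = sA , AllSimple-++ A' As B Bs sAs sB

parity : ∀ n → ∃ λ a → n ≡ 2 * a ⊎ n ≡ suc (2 * a)
parity zero    = 0 , inj₁ refl
parity (suc n) with parity n
... | a , inj₁ n≡2a  = a , inj₂ (cong suc n≡2a)
... | a , inj₂ n≡2a+1 = suc a , inj₁ (trans (cong suc n≡2a+1) (sym (*-suc 2 a)))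

odd-factor : ∀ d e q → d * e ≡ suc (2 * q) → ∃ λ a → d ≡ suc (2 * a)
odd-factor d e q de≡M with parity d
... | a , inj₂ d≡2a+1 = a , d≡2a+1
... | a , inj₁ d≡2a   = contradiction (begin
  2 * (a * e)   ≡⟨ *-assoc 2 a e ⟨
  2 * a * e     ≡⟨ cong (_* e) d≡2a ⟨
  d * e         ≡⟨ de≡M ⟩
  suc (2 * q)   ∎) (even≢odd (a * e) q)
  where open ≡-Reasoning

record OddFactorisation (q : ℕ) : Set where
  field
    a b     : ℕ
    1≤a     : 1 ≤ a
    1≤b     : 1 ≤ b
    a<q     : a < q
    b<q     : b < q
    product : suc (2 * a) * suc (2 * b) ≡ suc (2 * q)

odd-factorisation : ∀ d e q → d * e ≡ suc (2 * q) → 1 < d → d < suc (2 * q) →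
                    Σ (OddFactorisation q) λ F → d ≡ suc (2 * OddFactorisation.a F)
odd-factorisation d e q de≡M 1<d d<M with odd-factor d e q de≡M | odd-factor e d q (trans (*-comm e d) de≡M)
... | a , refl | b , refl = record
  { a = a ; b = b ; 1≤a = positive a 1<d ; 1≤b = positive b 1<e
  ; a<q = half< d<M ; b<q = half< e<M ; product = de≡M } , refl
  where
  positive : ∀ x → 1 < suc (2 * x) → 1 ≤ x
  positive zero    (s≤s ())
  positive (suc x) _ = s≤s z≤n
  half< : ∀ {x} → suc (2 * x) < suc (2 * q) → x < q
  half< lt = *-cancelˡ-< 2 _ _ (s<s⁻¹ lt)
  1<e : 1 < suc (2 * b)
  1<e = cofactor>1 b de≡M
    where
    cofactor>1 : ∀ x → suc (2 * a) * suc (2 * x) ≡ suc (2 * q) → 1 < suc (2 * x)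
    cofactor>1 zero    d≡M = contradiction (trans (sym (*-identityʳ _)) d≡M) (<⇒≢ d<M)
    cofactor>1 (suc x) _   = s≤s (s≤s z≤n)
  e<M : suc (2 * b) < suc (2 * q)
  e<M = subst (suc (2 * b) <_) (trans (*-comm (suc (2 * b)) (suc (2 * a))) de≡M) (m<m*n _ _ 1<d)

least : (P : ℕ → Set) → (∀ t → Dec (P t)) → ∀ n →
        (∀ t → t < n → ¬ P t) ⊎ Σ ℕ (λ t → t < n × P t × ∀ t' → t' < t → ¬ P t')
least P P? zero = inj₁ (λ t ())
least P P? (suc n) with least P P? n
... | inj₂ (t , t<n , Pt , below) = inj₂ (t , m<n⇒m<1+n t<n , Pt , below)
... | inj₁ none with P? n
...   | yes Pn = inj₂ (n , ≤-refl , Pn , none)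
...   | no ¬Pn = inj₁ λ t t<1+n → [ none t , (λ { refl → ¬Pn }) ]′ (m<1+n⇒m<n∨m≡n t<1+n)

-- Congruence modulo a positive modulus M.  Wrapping the defining equation in a
-- record lets Agda infer the two sides of a congruence from its type.
module Congruence (M : ℕ) .{{_ : NonZero M}} where

  infix 4 _≈_
  record _≈_ (a b : ℕ) : Set where
    constructor mk≈
    field un≈ : a % M ≡ b % M
  open _≈_ public

  ≈-refl : ∀ {a} → a ≈ a
  ≈-refl = mk≈ refl

  ≈-sym : ∀ {a b} → a ≈ b → b ≈ a
  ≈-sym (mk≈ p) = mk≈ (sym p)

  ≈-trans : ∀ {a b c} → a ≈ b → b ≈ c → a ≈ c
  ≈-trans (mk≈ p) (mk≈ q) = mk≈ (trans p q)

  ≡⇒≈ : ∀ {a b} → a ≡ b → a ≈ b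
  ≡⇒≈ refl = ≈-refl

  ≈-setoid : Setoid 0ℓ 0ℓ
  ≈-setoid = record
    { Carrier = ℕ ; _≈_ = _≈_
    ; isEquivalence = record { refl = ≈-refl ; sym = ≈-sym ; trans = ≈-trans } }

  module ≈-Reasoning = SetoidReasoning ≈-setoid

  +-≈ : ∀ {a a' b b'} → a ≈ a' → b ≈ b' → a + b ≈ a' + b'
  +-≈ {a} {a'} {b} {b'} (mk≈ p) (mk≈ q) = mk≈ (begin
    (a + b) % M             ≡⟨ %-distribˡ-+ a b M ⟩
    (a % M + b % M) % M     ≡⟨ cong₂ (λ x y → (x + y) % M) p q ⟩
    (a' % M + b' % M) % M   ≡⟨ %-distribˡ-+ a' b' M ⟨
    (a' + b') % M           ∎)
    where open ≡-Reasoning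

  %≈ : ∀ a → a % M ≈ a
  %≈ a = mk≈ (m%n%n≡m%n a M)

  0%M : 0 % M ≡ 0
  0%M = m<n⇒m%n≡m (>-nonZero⁻¹ M)

  k*M≈0 : ∀ k → k * M ≈ 0
  k*M≈0 k = mk≈ (trans (m*n%n≡0 k M) (sym 0%M))

  M≈0 : M ≈ 0
  M≈0 = mk≈ (trans (n%n≡0 M) (sym 0%M))

  neg : ℕ → ℕ
  neg c = M ∸ c % M

  neg+ : ∀ c → c + neg c ≈ 0
  neg+ c = begin
    c + neg c       ≈⟨ +-≈ (%≈ c) ≈-refl ⟨
    c % M + neg c   ≡⟨ m+[n∸m]≡n (<⇒≤ (m%n<n c M)) ⟩
    M               ≈⟨ M≈0 ⟩
    0               ∎
    where open ≈-Reasoning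

  +-cancelʳ-≈ : ∀ {a b c} → a + c ≈ b + c → a ≈ b
  +-cancelʳ-≈ {a} {b} {c} p = begin
    a                  ≡⟨ +-identityʳ a ⟨
    a + 0              ≈⟨ +-≈ (≈-refl {a}) (neg+ c) ⟨
    a + (c + neg c)    ≡⟨ +-assoc a c (neg c) ⟨
    a + c + neg c      ≈⟨ +-≈ p ≈-refl ⟩
    b + c + neg c      ≡⟨ +-assoc b c (neg c) ⟩
    b + (c + neg c)    ≈⟨ +-≈ (≈-refl {b}) (neg+ c) ⟩
    b + 0              ≡⟨ +-identityʳ b ⟩
    b                  ∎
    where open ≈-Reasoning

  residue-≡ : ∀ {a b} → a < M → b < M → a ≈ b → a ≡ b
  residue-≡ a<M b<M (mk≈ e) = trans (sym (m<n⇒m%n≡m a<M)) (trans e (m<n⇒m%n≡m b<M))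

  residue-≡0 : ∀ {a} → a < M → a ≈ 0 → a ≡ 0
  residue-≡0 a<M = residue-≡ a<M (>-nonZero⁻¹ M)

  toℕ-mod : ∀ a → toℕ (a mod M) ≡ a % M
  toℕ-mod a = toℕ-fromℕ< _

  toℕ-mod≈ : ∀ a → toℕ (a mod M) ≈ a
  toℕ-mod≈ a = ≈-trans (≡⇒≈ (toℕ-mod a)) (%≈ a)

  mod-cong : ∀ {a b} → a ≈ b → a mod M ≡ b mod M
  mod-cong (mk≈ e) = toℕ-injective (trans (toℕ-mod _) (trans e (sym (toℕ-mod _))))

  toℕ-mod-inverse : ∀ (i : Fin M) → toℕ i mod M ≡ i
  toℕ-mod-inverse i = toℕ-injective (trans (toℕ-mod (toℕ i)) (m<n⇒m%n≡m (toℕ<n i)))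

  Fin-≈ : ∀ {i j : Fin M} → toℕ i ≈ toℕ j → i ≡ j
  Fin-≈ e = toℕ-injective (residue-≡ (toℕ<n _) (toℕ<n _) e)

module _ {m n : ℕ} .{{_ : NonZero m}} .{{_ : NonZero n}} where
  private
    module Mod-m = Congruence m
    module Mod-n = Congruence n

  ≈-divisor : m ∣ n → ∀ {a b} → a Mod-n.≈ b → a Mod-m.≈ b
  ≈-divisor m∣n {a} {b} (Mod-n.mk≈ e) = Mod-m.mk≈ (begin
    a % m         ≡⟨ m∣n⇒o%n%m≡o%m m n a m∣n ⟨
    a % n % m     ≡⟨ cong (_% m) e ⟩
    b % n % m     ≡⟨ m∣n⇒o%n%m≡o%m m n b m∣n ⟩
    b % m         ∎)
    where open ≡-Reasoning

  ≈-scale : ∀ {N} .{{_ : NonZero N}} → N ≡ n * m → ∀ {a b} → a Mod-n.≈ b →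
            Congruence._≈_ N (m * a) (m * b)
  ≈-scale {N} N≡nm {a} {b} (Mod-n.mk≈ e) = Congruence.mk≈ (begin
    (m * a) % N          ≡⟨ cong (_% N) (*-comm m a) ⟩
    (a * m) % N          ≡⟨ %-congʳ N≡nm ⟩
    (a * m) % (n * m)    ≡⟨ m%n*o≡m*o%[n*o] a n m ⟨
    (a % n) * m          ≡⟨ cong (_* m) e ⟩
    (b % n) * m          ≡⟨ m%n*o≡m*o%[n*o] b n m ⟩
    (b * m) % (n * m)    ≡⟨ %-congʳ N≡nm ⟨
    (b * m) % N          ≡⟨ cong (_% N) (*-comm b m) ⟩
    (m * b) % N          ∎)
    where
    open ≡-Reasoning
    instance
      nm-nonZero : NonZero (n * m)
      nm-nonZero = m*n≢0 n m

module Residues (r : ℕ) where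
  open Congruence (suc (2 * r))

  negZ-+ : ∀ j → toℕ (negZ r j) + toℕ j ≈ 0
  negZ-+ j = begin
    toℕ (negZ r j) + toℕ j             ≈⟨ +-≈ (toℕ-mod≈ (suc (2 * r) ∸ toℕ j)) ≈-refl ⟩
    (suc (2 * r) ∸ toℕ j) + toℕ j      ≡⟨ m∸n+n≡m (<⇒≤ (toℕ<n j)) ⟩
    suc (2 * r)                        ≈⟨ M≈0 ⟩
    0                                  ∎
    where open ≈-Reasoning

  -- The natural number j + (M − i), congruent to j − i; subZ r j i is its residue.
  diff : Fin (suc (2 * r)) → Fin (suc (2 * r)) → ℕ
  diff i j = toℕ j + (suc (2 * r) ∸ toℕ i)

  diff-+ : ∀ i j → diff i j + toℕ i ≈ toℕ j
  diff-+ i j = begin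
    toℕ j + (suc (2 * r) ∸ toℕ i) + toℕ i    ≡⟨ +-assoc (toℕ j) _ _ ⟩
    toℕ j + (suc (2 * r) ∸ toℕ i + toℕ i)    ≡⟨ cong (toℕ j +_) (m∸n+n≡m (<⇒≤ (toℕ<n i))) ⟩
    toℕ j + suc (2 * r)                      ≈⟨ +-≈ (≈-refl {toℕ j}) M≈0 ⟩
    toℕ j + 0                                ≡⟨ +-identityʳ _ ⟩
    toℕ j                                    ∎
    where open ≈-Reasoning

  subZ-+ : ∀ j i → toℕ (subZ r j i) + toℕ i ≈ toℕ j
  subZ-+ j i = ≈-trans (+-≈ (toℕ-mod≈ (diff i j)) ≈-refl) (diff-+ i j)

  negZ-involutive : ∀ j → negZ r (negZ r j) ≡ j
  negZ-involutive j = Fin-≈ (+-cancelʳ-≈ (≈-trans (negZ-+ (negZ r j))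
    (≈-sym (≈-trans (≡⇒≈ (+-comm (toℕ j) _)) (negZ-+ j)))))

  negZ-zero : negZ r (zeroZ r) ≡ zeroZ r
  negZ-zero = Fin-≈ (≈-trans (≡⇒≈ (sym (+-identityʳ _))) (negZ-+ (zeroZ r)))

  -- The modulus is odd, so 0 is the only residue equal to its own negative.
  negZ-fixed⇒zero : ∀ j → j ≡ negZ r j → j ≡ zeroZ r
  negZ-fixed⇒zero j j≡-j = toℕ-injective (x≡0 (x + x <? suc (2 * r)))
    where
    x : ℕ
    x = toℕ j
    x+x≈0 : x + x ≈ 0
    x+x≈0 = ≈-trans (≡⇒≈ (cong (λ y → toℕ y + x) j≡-j)) (negZ-+ j)
    x≡0 : Dec (x + x < suc (2 * r)) → x ≡ 0
    x≡0 (yes x+x<M) = m+n≡0⇒m≡0 x (residue-≡0 x+x<M x+x≈0)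
    x≡0 (no x+x≮M) = contradiction 2x≡M (even≢odd x r)
      where
      M≤x+x : suc (2 * r) ≤ x + x
      M≤x+x = ≮⇒≥ x+x≮M
      excess≡0 : x + x ∸ suc (2 * r) ≡ 0
      excess≡0 = residue-≡0 (m<n+o⇒m∸n<o (x + x) (suc (2 * r)) (+-mono-< (toℕ<n j) (toℕ<n j)))
        (+-cancelʳ-≈ (≈-trans (≡⇒≈ (m∸n+n≡m M≤x+x)) (≈-trans x+x≈0 (≈-sym M≈0))))
      2x≡M : 2 * x ≡ suc (2 * r)
      2x≡M = trans (cong (x +_) (+-identityʳ x)) (≤-antisym (m∸n≡0⇒m≤n excess≡0) M≤x+x)

record OneOfEachPair (q : ℕ) (J : Subset (suc (2 * q))) : Set where
  field
    zero∉    : zeroZ q ∉ J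
    not-both : ∀ j → j ∈ J → negZ q j ∉ J
    one-of   : ∀ j → j ≢ zeroZ q → j ∈ J ⊎ negZ q j ∈ J

indicator : ∀ {n} → Subset n → Fin n → ℕ
indicator p i with lookup p i
... | true  = 1
... | false = 0

indicator-∈ : ∀ {n} (p : Subset n) i → i ∈ p → indicator p i ≡ 1
indicator-∈ p i i∈p with lookup p i | []=⇒lookup i∈p
... | true | _ = refl

indicator-∉ : ∀ {n} (p : Subset n) i → i ∉ p → indicator p i ≡ 0
indicator-∉ p i i∉p with lookup p i in eq
... | true  = contradiction (lookup⇒[]= i p eq) i∉p
... | false = refl

indicator≤1 : ∀ {n} (p : Subset n) i → indicator p i ≤ 1
indicator≤1 p i with lookup p i
... | true  = s≤s z≤n
... | false = z≤n

∣p∣≡sum-indicator : ∀ {n} (p : Subset n) → ∣ p ∣ ≡ sum (indicator p)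
∣p∣≡sum-indicator []          = refl
∣p∣≡sum-indicator (true ∷ p)  = cong suc (∣p∣≡sum-indicator p)
∣p∣≡sum-indicator (false ∷ p) = ∣p∣≡sum-indicator p

sum-ones : ∀ {n} (g : Fin n → ℕ) → (∀ i → g i ≡ 1) → sum g ≡ n
sum-ones {zero}  g g≡1 = refl
sum-ones {suc n} g g≡1 = cong₂ _+_ (g≡1 fzero) (sum-ones (λ i → g (fsuc i)) (λ i → g≡1 (fsuc i)))

sum≤n : ∀ {n} (g : Fin n → ℕ) → (∀ i → g i ≤ 1) → sum g ≤ n
sum≤n {zero}  g g≤1 = z≤n
sum≤n {suc n} g g≤1 = +-mono-≤ (g≤1 fzero) (sum≤n (λ i → g (fsuc i)) (λ i → g≤1 (fsuc i)))

sum<n : ∀ {n} (g : Fin n → ℕ) → (∀ i → g i ≤ 1) → ∀ b → g b ≡ 0 → sum g < n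
sum<n {suc n} g g≤1 fzero    gb≡0 rewrite gb≡0 = s≤s (sum≤n (λ i → g (fsuc i)) (λ i → g≤1 (fsuc i)))
sum<n {suc n} g g≤1 (fsuc b) gb≡0 = subst (_≤ suc n) (+-suc (g fzero) _)
  (+-mono-≤ (g≤1 fzero) (sum<n (λ i → g (fsuc i)) (λ i → g≤1 (fsuc i)) b gb≡0))

-- Counting the pairs {j, −j}: since 0 ∉ J and J contains no pair j, −j, the
-- condition |J| = r (half the nonzero residues) says exactly that J meets every pair.
module Counting (r : ℕ) (J : Subset (suc (2 * r)))
                (zero∉ : zeroZ r ∉ J) (not-both : ∀ j → j ∈ J → negZ r j ∉ J) where
  open Residues r

  pairCount : Fin (suc (2 * r)) → ℕ
  pairCount i = indicator J i + indicator J (negZ r i)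

  sum-pairCount : sum pairCount ≡ ∣ J ∣ + ∣ J ∣
  sum-pairCount = begin
    sum pairCount
      ≡⟨ ∑-distrib-+ (indicator J) (λ i → indicator J (negZ r i)) ⟩
    sum (indicator J) + sum (λ i → indicator J (negZ r i))
      ≡⟨ cong (sum (indicator J) +_) (sum-permute (indicator J) negation) ⟨
    sum (indicator J) + sum (indicator J)
      ≡⟨ cong₂ _+_ (∣p∣≡sum-indicator J) (∣p∣≡sum-indicator J) ⟨
    ∣ J ∣ + ∣ J ∣
      ∎
    where
    open ≡-Reasoning
    negation : Permutation′ (suc (2 * r))
    negation = permutation (negZ r) (negZ r) negZ-involutive negZ-involutive

  zeroZ≡fzero : zeroZ r ≡ fzero
  zeroZ≡fzero = toℕ-injective refl

  pairCount-zero : pairCount fzero ≡ 0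
  pairCount-zero = cong₂ _+_ (indicator-∉ J fzero 0∉J)
    (trans (cong (indicator J) (trans (cong (negZ r) (sym zeroZ≡fzero)) (trans negZ-zero zeroZ≡fzero)))
           (indicator-∉ J fzero 0∉J))
    where
    0∉J : fzero ∉ J
    0∉J = subst (_∉ J) zeroZ≡fzero zero∉

  pairCount≤1 : ∀ i → pairCount i ≤ 1
  pairCount≤1 i with i ∈? J
  ... | yes i∈J rewrite indicator-∈ J i i∈J | indicator-∉ J (negZ r i) (not-both i i∈J) = s≤s z≤n
  ... | no  i∉J rewrite indicator-∉ J i i∉J = indicator≤1 J (negZ r i)

  card⇒one-of : ∣ J ∣ ≡ r → ∀ j → j ≢ zeroZ r → j ∈ J ⊎ negZ r j ∈ J
  card⇒one-of card fzero    j≢0 = contradiction (sym zeroZ≡fzero) j≢0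
  card⇒one-of card (fsuc j) j≢0 with fsuc j ∈? J | negZ r (fsuc j) ∈? J
  ... | yes j∈J | _        = inj₁ j∈J
  ... | no _    | yes -j∈J = inj₂ -j∈J
  ... | no j∉J  | no -j∉J  = contradiction sum≡2r (<⇒≢ sum<2r)
    where
    sum<2r : sum pairCount < 2 * r
    sum<2r = subst (_< 2 * r) (cong (_+ sum (λ i → pairCount (fsuc i))) (sym pairCount-zero))
      (sum<n (λ i → pairCount (fsuc i)) (λ i → pairCount≤1 (fsuc i)) j
             (cong₂ _+_ (indicator-∉ J _ j∉J) (indicator-∉ J _ -j∉J)))
    sum≡2r : sum pairCount ≡ 2 * r
    sum≡2r = trans sum-pairCount (trans (cong₂ _+_ card card) (cong (r +_) (sym (+-identityʳ r))))

  one-of⇒card : (∀ j → j ≢ zeroZ r → j ∈ J ⊎ negZ r j ∈ J) → ∣ J ∣ ≡ r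
  one-of⇒card one-of = *-cancelˡ-≡ ∣ J ∣ r 2 (begin
    2 * ∣ J ∣             ≡⟨ cong (∣ J ∣ +_) (+-identityʳ ∣ J ∣) ⟩
    ∣ J ∣ + ∣ J ∣         ≡⟨ sum-pairCount ⟨
    sum pairCount         ≡⟨ cong₂ _+_ pairCount-zero (sum-ones (λ i → pairCount (fsuc i)) pairCount-nonzero) ⟩
    2 * r                 ∎)
    where
    open ≡-Reasoning
    pairCount-nonzero : ∀ i → pairCount (fsuc i) ≡ 1
    pairCount-nonzero i with one-of (fsuc i) (λ e → 0≢1+n (cong toℕ (sym e)))
    ... | inj₁ i∈J rewrite indicator-∈ J _ i∈J | indicator-∉ J _ (not-both _ i∈J) = refl
    ... | inj₂ -i∈J with fsuc i ∈? J
    ...   | yes i∈J = contradiction -i∈J (not-both _ i∈J)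
    ...   | no  i∉J rewrite indicator-∉ J _ i∉J | indicator-∈ J _ -i∈J = refl

symbol⇒axioms : ∀ {q} {J : Subset (suc (2 * q))} → IsSymbolSet q J → OneOfEachPair q J
symbol⇒axioms {q} {J} (zero∉ , card , pair) = record
  { zero∉ = zero∉ ; not-both = not-both ; one-of = Counting.card⇒one-of q J zero∉ not-both card }
  where
  not-both : ∀ j → j ∈ J → negZ q j ∉ J
  not-both j j∈J -j∈J = zero∉ (subst (_∈ J) (Residues.negZ-fixed⇒zero q j (pair j j∈J -j∈J)) j∈J)

axioms⇒symbol : ∀ {q} {J : Subset (suc (2 * q))} → OneOfEachPair q J → IsSymbolSet q J
axioms⇒symbol {q} {J} ax = zero∉ , Counting.one-of⇒card q J zero∉ not-both one-of ,
                           λ j j∈J -j∈J → contradiction -j∈J (not-both j j∈J)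
  where open OneOfEachPair ax

preimage : ∀ {n m} → (Fin n → Fin m) → Subset m → Subset n
preimage f K = tabulate (λ i → lookup K (f i))

∈-preimage⁻ : ∀ {n m} (f : Fin n → Fin m) K i → i ∈ preimage f K → f i ∈ K
∈-preimage⁻ f K i i∈ = lookup⇒[]= (f i) K (trans (sym (lookup∘tabulate _ i)) ([]=⇒lookup i∈))

∈-preimage⁺ : ∀ {n m} (f : Fin n → Fin m) K i → f i ∈ K → i ∈ preimage f K
∈-preimage⁺ f K i fi∈ = lookup⇒[]= i (preimage f K) (trans (lookup∘tabulate _ i) ([]=⇒lookup fi∈))

module Circulant (q : ℕ) (J : Subset (suc (2 * q))) (ax : OneOfEachPair q J) where
  open OneOfEachPair ax
  open Congruence (suc (2 * q)) public
  open Residues q public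

  M : ℕ
  M = suc (2 * q)

  InJ : ℕ → Set
  InJ a = (a mod M) ∈ J

  InJ-≈ : ∀ {a b} → a ≈ b → InJ a → InJ b
  InJ-≈ e = subst (_∈ J) (mod-cong e)

  negZ-mod : ∀ a b → a + b ≈ 0 → negZ q (a mod M) ≡ b mod M
  negZ-mod a b a+b≈0 = Fin-≈ (+-cancelʳ-≈ (≈-trans (negZ-+ (a mod M)) (≈-sym (begin
    toℕ (b mod M) + toℕ (a mod M)   ≈⟨ +-≈ (toℕ-mod≈ b) (toℕ-mod≈ a) ⟩
    b + a                           ≡⟨ +-comm b a ⟩
    a + b                           ≈⟨ a+b≈0 ⟩
    0                               ∎))))
    where open ≈-Reasoning

  InJ-zero : ∀ {a} → a ≈ 0 → ¬ InJ a
  InJ-zero a≈0 a∈J = zero∉ (InJ-≈ a≈0 a∈J)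

  InJ-not-both : ∀ a b → a + b ≈ 0 → InJ a → InJ b → ⊥
  InJ-not-both a b a+b≈0 a∈J b∈J = not-both (a mod M) a∈J (subst (_∈ J) (sym (negZ-mod a b a+b≈0)) b∈J)

  InJ-one-of : ∀ a b → a + b ≈ 0 → ¬ (a ≈ 0) → InJ a ⊎ InJ b
  InJ-one-of a b a+b≈0 a≉0 with one-of (a mod M) (λ e → a≉0 (≈-trans (≈-sym (toℕ-mod≈ a)) (≡⇒≈ (cong toℕ e))))
  ... | inj₁ a∈J  = inj₁ a∈J
  ... | inj₂ -a∈J = inj₂ (subst (_∈ J) (negZ-mod a b a+b≈0) -a∈J)

  Ar : Fin M → Fin M → Set
  Ar = Arc (Circ q J)

  Ar? : ∀ i j → Dec (Ar i j)
  Ar? i j = (diff i j mod M) ∈? J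

  diff-≈ : ∀ {a} i j → a + toℕ i ≈ toℕ j → a ≈ diff i j
  diff-≈ i j e = +-cancelʳ-≈ (≈-trans e (≈-sym (diff-+ i j)))

  Ar⇒InJ : ∀ {a} i j → a + toℕ i ≈ toℕ j → Ar i j → InJ a
  Ar⇒InJ i j e = InJ-≈ (≈-sym (diff-≈ i j e))

  InJ⇒Ar : ∀ {a} i j → a + toℕ i ≈ toℕ j → InJ a → Ar i j
  InJ⇒Ar i j e = InJ-≈ (diff-≈ i j e)

  diff-antisym : ∀ i j → diff i j + diff j i ≈ 0
  diff-antisym i j = +-cancelʳ-≈ {c = toℕ j} (begin
    diff i j + diff j i + toℕ j     ≡⟨ +-assoc (diff i j) _ _ ⟩
    diff i j + (diff j i + toℕ j)   ≈⟨ +-≈ (≈-refl {diff i j}) (diff-+ j i) ⟩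
    diff i j + toℕ i                ≈⟨ diff-+ i j ⟩
    toℕ j                           ∎)
    where open ≈-Reasoning

  Ar-antisym : ∀ i j → Ar i j → ¬ Ar j i
  Ar-antisym i j = InJ-not-both (diff i j) (diff j i) (diff-antisym i j)

  Ar-total : ∀ i j → i ≢ j → Ar i j ⊎ Ar j i
  Ar-total i j i≢j = InJ-one-of (diff i j) (diff j i) (diff-antisym i j)
    (λ d≈0 → i≢j (Fin-≈ (≈-sym (≈-trans (≈-sym (diff-+ i j)) (+-≈ d≈0 (≈-refl {toℕ i}))))))

  τ : Fin M → Fin M → Fin M
  τ g i = (toℕ i + toℕ g) mod M

  τ-≈ : ∀ g i → toℕ (τ g i) ≈ toℕ i + toℕ g
  τ-≈ g i = toℕ-mod≈ _

  τ-diff : ∀ g i j → diff i j + toℕ (τ g i) ≈ toℕ (τ g j)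
  τ-diff g i j = begin
    diff i j + toℕ (τ g i)          ≈⟨ +-≈ (≈-refl {diff i j}) (τ-≈ g i) ⟩
    diff i j + (toℕ i + toℕ g)      ≡⟨ +-assoc (diff i j) _ _ ⟨
    diff i j + toℕ i + toℕ g        ≈⟨ +-≈ (diff-+ i j) ≈-refl ⟩
    toℕ j + toℕ g                   ≈⟨ τ-≈ g j ⟨
    toℕ (τ g j)                     ∎
    where open ≈-Reasoning

  τ-arc : ∀ g i j → Ar i j → Ar (τ g i) (τ g j)
  τ-arc g i j = InJ⇒Ar (τ g i) (τ g j) (τ-diff g i j)

  τ-arc⁻ : ∀ g i j → Ar (τ g i) (τ g j) → Ar i j
  τ-arc⁻ g i j = Ar⇒InJ (τ g i) (τ g j) (τ-diff g i j)

  τ-zero : ∀ g → τ g (zeroZ q) ≡ g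
  τ-zero g = toℕ-mod-inverse g

  τ-neg : ∀ g → τ (negZ q g) g ≡ zeroZ q
  τ-neg g = Fin-≈ (≈-trans (τ-≈ (negZ q g) g) (≈-trans (≡⇒≈ (+-comm (toℕ g) _)) (negZ-+ g)))

  τ-inverseʳ : ∀ g i → τ (negZ q g) (τ g i) ≡ i
  τ-inverseʳ g i = Fin-≈ (begin
    toℕ (τ (negZ q g) (τ g i))             ≈⟨ τ-≈ (negZ q g) (τ g i) ⟩
    toℕ (τ g i) + toℕ (negZ q g)           ≈⟨ +-≈ (τ-≈ g i) ≈-refl ⟩
    toℕ i + toℕ g + toℕ (negZ q g)         ≡⟨ +-assoc (toℕ i) _ _ ⟩
    toℕ i + (toℕ g + toℕ (negZ q g))       ≡⟨ cong (toℕ i +_) (+-comm (toℕ g) _) ⟩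
    toℕ i + (toℕ (negZ q g) + toℕ g)       ≈⟨ +-≈ (≈-refl {toℕ i}) (negZ-+ g) ⟩
    toℕ i + 0                              ≡⟨ +-identityʳ _ ⟩
    toℕ i                                  ∎)
    where open ≈-Reasoning

  τ-inverseˡ : ∀ g i → τ g (τ (negZ q g) i) ≡ i
  τ-inverseˡ g i = trans (cong (λ h → τ h (τ (negZ q g) i)) (sym (negZ-involutive g)))
                         (τ-inverseʳ (negZ q g) i)

  τ-injective : ∀ g i j → τ g i ≡ τ g j → i ≡ j
  τ-injective g i j e = trans (sym (τ-inverseʳ g i)) (trans (cong (τ (negZ q g)) e) (τ-inverseʳ g j))

  -- Strong connectivity: a set closed under out-arcs that contains a also contains
  -- every in-neighbour b of a, since with s = a − b the walk a, a+s, …, a+2q·s = b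
  -- follows arcs.
  out-closed⇒in-closed : (S : Fin M → Set) → (∀ u v → Ar u v → S u → S v) →
                         ∀ a b → Ar b a → S a → S b
  out-closed⇒in-closed S closed a b b→a a∈S = subst S walk-end (walk (2 * q))
    where
    s : ℕ
    s = diff b a
    point : ℕ → Fin M
    point k = (toℕ a + k * s) mod M
    step : ∀ k → s + toℕ (point k) ≈ toℕ (point (suc k))
    step k = begin
      s + toℕ (point k)         ≈⟨ +-≈ (≈-refl {s}) (toℕ-mod≈ (toℕ a + k * s)) ⟩
      s + (toℕ a + k * s)       ≡⟨ rearrange (toℕ a) k s ⟩
      toℕ a + suc k * s         ≈⟨ toℕ-mod≈ _ ⟨
      toℕ (point (suc k))       ∎
      where
      open ≈-Reasoning
      rearrange : ∀ x y z → z + (x + y * z) ≡ x + (z + y * z)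
      rearrange = solve-∀
    walk : ∀ k → S (point k)
    walk zero    = subst S (trans (sym (toℕ-mod-inverse a)) (cong (_mod M) (sym (+-identityʳ (toℕ a))))) a∈S
    walk (suc k) = closed (point k) (point (suc k)) (InJ⇒Ar (point k) (point (suc k)) (step k) b→a) (walk k)
    walk-end : point (2 * q) ≡ b
    walk-end = Fin-≈ (+-cancelʳ-≈ {c = s} (begin
      toℕ (point (2 * q)) + s       ≈⟨ +-≈ (toℕ-mod≈ (toℕ a + 2 * q * s)) ≈-refl ⟩
      toℕ a + 2 * q * s + s         ≡⟨ rearrange (toℕ a) (2 * q) s ⟩
      toℕ a + s * M                 ≈⟨ +-≈ (≈-refl {toℕ a}) (k*M≈0 s) ⟩
      toℕ a + 0                     ≡⟨ +-identityʳ _ ⟩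
      toℕ a                         ≈⟨ diff-+ b a ⟨
      s + toℕ b                     ≡⟨ +-comm s (toℕ b) ⟩
      toℕ b + s                     ∎))
      where
      open ≈-Reasoning
      rearrange : ∀ x y z → x + y * z + z ≡ x + z * suc y
      rearrange = solve-∀

  ¬dominating : ∀ (S : Subset M) a b → a ∈ S → b ∉ S → ¬ (∀ u v → u ∈ S → v ∉ S → Ar u v)
  ¬dominating S a b a∈S b∉S dominating =
    out-closed⇒in-closed (_∉ S) complement-closed b a (dominating a b a∈S b∉S) b∉S a∈S
    where
    complement-closed : ∀ u v → Ar u v → u ∉ S → v ∉ S
    complement-closed u v u→v u∉S v∈S = Ar-antisym u v u→v (dominating v u v∈S u∉S)

  ¬dominated : ∀ (S : Subset M) a b → a ∈ S → b ∉ S → ¬ (∀ u v → u ∈ S → v ∉ S → Ar v u)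
  ¬dominated S a b a∈S b∉S dominated =
    b∉S (out-closed⇒in-closed (_∈ S) closed a b (dominated a b a∈S b∉S) a∈S)
    where
    closed : ∀ u v → Ar u v → u ∈ S → v ∈ S
    closed u v u→v u∈S with v ∈? S
    ... | yes v∈S = v∈S
    ... | no  v∉S = contradiction (dominated u v u∈S v∉S) (Ar-antisym u v u→v)

module Modules (q : ℕ) (J : Subset (suc (2 * q))) (ax : OneOfEachPair q J) where
  open Circulant q J ax public

  Module : Subset M → Set
  Module K = ∀ x y z → x ∉ K → y ∈ K → z ∈ K → (Ar x y → Ar x z) × (Ar y x → Ar z x)

  Big : Subset M → Set
  Big K = Σ (Fin M) λ y → Σ (Fin M) λ z → y ∈ K × z ∈ K × y ≢ z

  Proper : Subset M → Set
  Proper K = ∃ λ c → c ∉ K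

  Nontrivial : Subset M → Set
  Nontrivial K = Module K × Big K × Proper K

  Maximal : Subset M → Set
  Maximal K = ∀ N → Module N → K ⊆ N → Proper N → N ⊆ K

  Module? : ∀ K → Dec (Module K)
  Module? K = all? λ x → all? λ y → all? λ z →
    ¬? (x ∈? K) →-dec (y ∈? K) →-dec (z ∈? K) →-dec
    ((Ar? x y →-dec Ar? x z) ×-dec (Ar? y x →-dec Ar? z x))

  Big? : ∀ K → Dec (Big K)
  Big? K = any? λ y → any? λ z → (y ∈? K) ×-dec (z ∈? K) ×-dec ¬? (y ≟F z)

  Proper? : ∀ K → Dec (Proper K)
  Proper? K = any? λ c → ¬? (c ∈? K)

  Nontrivial? : ∀ K → Dec (Nontrivial K)
  Nontrivial? K = Module? K ×-dec Big? K ×-dec Proper? K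

  shift : Fin M → Subset M → Subset M
  shift g = preimage (τ g)

  shift-module : ∀ g K → Module K → Module (shift g K)
  shift-module g K mK x y z x∉ y∈ z∈ =
    (λ x→y → τ-arc⁻ g x z (proj₁ uniform (τ-arc g x y x→y))) ,
    (λ y→x → τ-arc⁻ g z x (proj₂ uniform (τ-arc g y x y→x)))
    where
    uniform : (Ar (τ g x) (τ g y) → Ar (τ g x) (τ g z)) × (Ar (τ g y) (τ g x) → Ar (τ g z) (τ g x))
    uniform = mK (τ g x) (τ g y) (τ g z) (λ h → x∉ (∈-preimage⁺ (τ g) K x h))
                 (∈-preimage⁻ (τ g) K y y∈) (∈-preimage⁻ (τ g) K z z∈)

  ∈-shift⁺ : ∀ g K y → y ∈ K → τ (negZ q g) y ∈ shift g K
  ∈-shift⁺ g K y y∈K = ∈-preimage⁺ (τ g) K _ (subst (_∈ K) (sym (τ-inverseˡ g y)) y∈K)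

  ∈-shift⁻ : ∀ g K y → τ (negZ q g) y ∈ shift g K → y ∈ K
  ∈-shift⁻ g K y h = subst (_∈ K) (τ-inverseˡ g y) (∈-preimage⁻ (τ g) K _ h)

  shift-proper : ∀ g K → Proper K → Proper (shift g K)
  shift-proper g K (c , c∉K) = τ (negZ q g) c , λ h → c∉K (∈-shift⁻ g K c h)

  shift-big : ∀ g K → Big K → Big (shift g K)
  shift-big g K (y , z , y∈K , z∈K , y≢z) = τ (negZ q g) y , τ (negZ q g) z ,
    ∈-shift⁺ g K y y∈K , ∈-shift⁺ g K z z∈K , λ e → y≢z (τ-injective (negZ q g) y z e)

  ∪-module : ∀ {K N g} → Module K → Module N → g ∈ K → g ∈ N → Module (K ∪ N)
  ∪-module {K} {N} {g} mK mN g∈K g∈N x y z x∉ y∈ z∈ =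
    (λ x→y → proj₁ (from-g z∈) (proj₁ (to-g y∈) x→y)) ,
    (λ y→x → proj₂ (from-g z∈) (proj₂ (to-g y∈) y→x))
    where
    x∉K : x ∉ K
    x∉K h = x∉ (x∈p∪q⁺ (inj₁ h))
    x∉N : x ∉ N
    x∉N h = x∉ (x∈p∪q⁺ (inj₂ h))
    to-g : ∀ {y} → y ∈ K ∪ N → (Ar x y → Ar x g) × (Ar y x → Ar g x)
    to-g {y} y∈ = [ (λ y∈K → mK x y g x∉K y∈K g∈K) , (λ y∈N → mN x y g x∉N y∈N g∈N) ]′ (x∈p∪q⁻ K N y∈)
    from-g : ∀ {z} → z ∈ K ∪ N → (Ar x g → Ar x z) × (Ar g x → Ar z x)
    from-g {z} z∈ = [ (λ z∈K → mK x g z x∉K g∈K z∈K) , (λ z∈N → mN x g z x∉N g∈N z∈N) ]′ (x∈p∪q⁻ K N z∈)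

  -- Every proper module lies in a maximal proper module: enlarge it while possible;
  -- each enlargement increases the cardinality, so M steps suffice.
  extend-to-maximal : ∀ K → Module K → Proper K →
                      Σ (Subset M) λ K' → Module K' × Proper K' × K ⊆ K' × Maximal K'
  extend-to-maximal K = go M K (m≤n+m M ∣ K ∣)
    where
    go : ∀ fuel K → M ≤ ∣ K ∣ + fuel → Module K → Proper K →
         Σ (Subset M) λ K' → Module K' × Proper K' × K ⊆ K' × Maximal K'
    go zero K bound mK (c , c∉K) = contradiction (subst (c ∈_) (sym K≡⊤) ∈⊤) c∉K
      where
      K≡⊤ : K ≡ ⊤
      K≡⊤ = ∣p∣≡n⇒p≡⊤ (≤-antisym (∣p∣≤n K) (subst (M ≤_) (+-identityʳ _) bound))
    go (suc fuel) K bound mK pK with anySubset? (λ N → Module? N ×-dec Proper? N ×-dec K ⊂? N)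
    ... | yes (N , mN , pN , K⊂N) with go fuel N (≤-trans bound (≤-trans (≤-reflexive (+-suc ∣ K ∣ fuel))
                                                     (+-monoˡ-≤ fuel (p⊂q⇒∣p∣<∣q∣ K⊂N)))) mN pN
    ...   | K' , mK' , pK' , N⊆K' , maxK' = K' , mK' , pK' , (λ x∈K → N⊆K' (proj₁ K⊂N x∈K)) , maxK'
    go (suc fuel) K bound mK pK | no no-enlargement = K , mK , pK , (λ x∈K → x∈K) , maximal
      where
      maximal : Maximal K
      maximal N mN K⊆N pN {x} x∈N with x ∈? K
      ... | yes x∈K = x∈K
      ... | no  x∉K = contradiction (N , mN , pN , (λ {y} → K⊆N {y}) , x , x∈N , x∉K) no-enlargement

  -- Two overlapping modules that together cover all vertices are nested.  Otherwise,
  -- with x ∈ K∖N and w ∈ N∖K, the arc between x and a common element g forces N to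
  -- dominate its complement (= K∖N) or to be dominated by it.
  covering-modules-nested : ∀ {K N g} → Module K → Module N → g ∈ K → g ∈ N →
    (∀ y → y ∈ K ⊎ y ∈ N) → ∀ x w → x ∈ K → x ∉ N → w ∈ N → w ∉ K → ⊥
  covering-modules-nested {K} {N} {g} mK mN g∈K g∈N cover x w x∈K x∉N w∈N w∉K
    with Ar-total x g (λ { refl → x∉N g∈N })
  ... | inj₁ x→g = ¬dominated N w x w∈N x∉N λ u v u∈N v∉N →
          proj₁ (mN v w u v∉N w∈N u∈N) (proj₂ (mK w x v w∉K x∈K (in-K v∉N)) x→w)
    where
    x→w : Ar x w
    x→w = proj₁ (mN x g w x∉N g∈N w∈N) x→g
    in-K : ∀ {v} → v ∉ N → v ∈ K
    in-K {v} v∉N = [ (λ v∈K → v∈K) , (λ v∈N → contradiction v∈N v∉N) ]′ (cover v)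
  ... | inj₂ g→x = ¬dominating N w x w∈N x∉N λ u v u∈N v∉N →
          proj₂ (mN v w u v∉N w∈N u∈N) (proj₁ (mK w x v w∉K x∈K (in-K v∉N)) w→x)
    where
    w→x : Ar w x
    w→x = proj₂ (mN x g w x∉N g∈N w∈N) g→x
    in-K : ∀ {v} → v ∉ N → v ∈ K
    in-K {v} v∉N = [ (λ v∈K → v∈K) , (λ v∈N → contradiction v∈N v∉N) ]′ (cover v)

  -- A maximal proper module K containing 0 is closed under translation by its own
  -- elements: for g ∈ K the translate N = K + g is a proper module through g, and
  -- it must lie inside K.
  maximal-translation-closed : ∀ K → Module K → Proper K → zeroZ q ∈ K → Maximal K →
                               ∀ g x → g ∈ K → x ∈ K → τ g x ∈ K
  maximal-translation-closed K mK pK 0∈K maxK g x g∈K x∈K =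
    N⊆K (∈-preimage⁺ (τ (negZ q g)) K (τ g x) (subst (_∈ K) (sym (τ-inverseʳ g x)) x∈K))
    where
    N : Subset M
    N = shift (negZ q g) K
    mN : Module N
    mN = shift-module (negZ q g) K mK
    pN : Proper N
    pN = shift-proper (negZ q g) K pK
    g∈N : g ∈ N
    g∈N = ∈-preimage⁺ (τ (negZ q g)) K g (subst (_∈ K) (sym (τ-neg g)) 0∈K)
    N⊆K : N ⊆ K
    N⊆K {w} w∈N with any? (λ y → ¬? (y ∈? K) ×-dec ¬? (y ∈? N))
    ... | yes (y , y∉K , y∉N) = maxK (K ∪ N) (∪-module mK mN g∈K g∈N) (λ h → x∈p∪q⁺ (inj₁ h))
                                  (y , λ h → [ y∉K , y∉N ]′ (x∈p∪q⁻ K N h)) (x∈p∪q⁺ (inj₂ w∈N))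
    ... | no uncovered with any? (λ y → (y ∈? K) ×-dec ¬? (y ∈? N))
    ...   | no K⊈N = maxK N mN K⊆N pN w∈N
      where
      K⊆N : K ⊆ N
      K⊆N {y} y∈K with y ∈? N
      ... | yes y∈N = y∈N
      ... | no  y∉N = contradiction (y , y∈K , y∉N) K⊈N
    ...   | yes (x' , x'∈K , x'∉N) with w ∈? K
    ...     | yes w∈K = w∈K
    ...     | no  w∉K = ⊥-elim (covering-modules-nested mK mN g∈K g∈N cover x' w x'∈K x'∉N w∈N w∉K)
      where
      cover : ∀ y → y ∈ K ⊎ y ∈ N
      cover y with y ∈? K | y ∈? N
      ... | yes y∈K | _       = inj₁ y∈K
      ... | no _    | yes y∈N = inj₂ y∈N
      ... | no y∉K  | no y∉N  = contradiction (y , y∉K , y∉N) uncovered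

module Periodicity (q : ℕ) (J : Subset (suc (2 * q))) (ax : OneOfEachPair q J) where
  open Modules q J ax public

  Periodic : (d : ℕ) .{{_ : NonZero d}} → Set
  Periodic d = ∀ u v → u % d ≡ v % d → u % d ≢ 0 → InJ u → InJ v

  Periodic-cong : ∀ {d d'} .{{_ : NonZero d}} .{{_ : NonZero d'}} → d ≡ d' → Periodic d → Periodic d'
  Periodic-cong refl periodic = periodic

  record Splitting : Set where
    field
      factors  : OddFactorisation q
      periodic : Periodic (suc (2 * OddFactorisation.a factors))

  module Subgroup (K : Subset M) (0∈K : zeroZ q ∈ K) (closed : ∀ g x → g ∈ K → x ∈ K → τ g x ∈ K) where

    InK : ℕ → Set
    InK t = (t mod M) ∈ K

    InK-≈ : ∀ {a b} → a ≈ b → InK a → InK b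
    InK-≈ e = subst (_∈ K) (mod-cong e)

    InK-toℕ : ∀ x → x ∈ K → InK (toℕ x)
    InK-toℕ x = subst (_∈ K) (sym (toℕ-mod-inverse x))

    InK-+ : ∀ a b → InK a → InK b → InK (a + b)
    InK-+ a b a∈K b∈K = InK-≈ (+-≈ (toℕ-mod≈ a) (toℕ-mod≈ b)) (closed (b mod M) (a mod M) b∈K a∈K)

    InK-* : ∀ k a → InK a → InK (k * a)
    InK-* zero    a a∈K = 0∈K
    InK-* (suc k) a a∈K = InK-+ a (k * a) a∈K (InK-* k a a∈K)

    PositiveInK : ℕ → Set
    PositiveInK t = 0 < t × InK t

    PositiveInK? : ∀ t → Dec (PositiveInK t)
    PositiveInK? t = (0 <? t) ×-dec ((t mod M) ∈? K)

    positive-element : Big K → ∃ λ t → t < M × PositiveInK t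
    positive-element (y , z , y∈K , z∈K , y≢z) with toℕ y ≟ 0
    ... | no  y≢0 = toℕ y , toℕ<n y , n≢0⇒n>0 y≢0 , InK-toℕ y y∈K
    ... | yes y≡0 = toℕ z , toℕ<n z ,
                    n≢0⇒n>0 (λ z≡0 → y≢z (toℕ-injective (trans y≡0 (sym z≡0)))) , InK-toℕ z z∈K

    least-positive : Big K → Σ ℕ λ d → d < M × PositiveInK d × ∀ t → t < d → ¬ PositiveInK t
    least-positive big with least PositiveInK PositiveInK? M | positive-element big
    ... | inj₁ none  | t , t<M , t∈K = contradiction t∈K (none t t<M)
    ... | inj₂ found | _             = found

    -- If moreover K is a proper module, its least positive element d generates it:
    -- K = dℤ_M, d is a nontrivial divisor of M, and J is periodic modulo d.
    module Generator (mK : Module K) (pK : Proper K) (d : ℕ) (d<M : d < M) (0<d : 0 < d) (d∈K : InK d)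
                     (minimal : ∀ t → t < d → ¬ PositiveInK t) where

      instance
        d-nonZero : NonZero d
        d-nonZero = >-nonZero 0<d

      InK⇒∣ : ∀ t → InK t → d ∣ t
      InK⇒∣ t t∈K with t % d ≟ 0
      ... | yes r≡0 = m%n≡0⇒n∣m t d r≡0
      ... | no  r≢0 = contradiction (n≢0⇒n>0 r≢0 , r∈K) (minimal (t % d) (m%n<n t d))
        where
        k : ℕ
        k = t / d
        -- t % d = t − k·d ≡ t + 2q·k·d (mod M)
        r≈ : t + 2 * q * (k * d) ≈ t % d
        r≈ = begin
          t + 2 * q * (k * d)                   ≡⟨ cong (_+ 2 * q * (k * d)) (m≡m%n+[m/n]*n t d) ⟩
          t % d + k * d + 2 * q * (k * d)       ≡⟨ rearrange (t % d) (k * d) q ⟩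
          t % d + (k * d) * M                   ≈⟨ +-≈ (≈-refl {t % d}) (k*M≈0 (k * d)) ⟩
          t % d + 0                             ≡⟨ +-identityʳ _ ⟩
          t % d                                 ∎
          where
          open ≈-Reasoning
          rearrange : ∀ r x q → r + x + 2 * q * x ≡ r + x * suc (2 * q)
          rearrange = solve-∀
        r∈K : InK (t % d)
        r∈K = InK-≈ r≈ (InK-+ t _ t∈K (InK-* (2 * q) (k * d) (InK-* k d d∈K)))

      ∣⇒InK : ∀ t → d ∣ t → InK t
      ∣⇒InK t (divides k t≡kd) = subst InK (sym t≡kd) (InK-* k d d∈K)

      d∣M : d ∣ M
      d∣M = InK⇒∣ M (InK-≈ (≈-sym M≈0) 0∈K)

      d≢1 : Proper K → d ≢ 1
      d≢1 (c , c∉K) d≡1 = c∉K (subst (_∈ K) (toℕ-mod-inverse c) (∣⇒InK (toℕ c) d∣c))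
        where
        d∣c : d ∣ toℕ c
        d∣c = subst (_∣ toℕ c) (sym d≡1) (divides (toℕ c) (sym (*-identityʳ (toℕ c))))

      1<d : 1 < d
      1<d = ≤∧≢⇒< 0<d (λ e → d≢1 pK (sym e))

      -- J is periodic modulo d: put x = −u.  Then 0 and v − u lie in K while x does
      -- not, and x → 0 since 0 − x = u ∈ J; as K is a module also x → v − u, whose
      -- difference from x is v.
      periodic : Periodic d
      periodic u v u≡v u≢0 u∈J =
        Ar⇒InJ x z (≈-trans (+-≈ (≈-refl {v}) (toℕ-mod≈ _)) (≈-sym (toℕ-mod≈ _)))
               (proj₁ (mK x (zeroZ q) z x∉K 0∈K z∈K) x→0)
        where
        module Mod-d = Congruence d
        x z : Fin M
        x = (2 * q * u) mod M
        z = (v + 2 * q * u) mod M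
        u+x≡uM : u + 2 * q * u ≡ u * M
        u+x≡uM = rearrange u q
          where
          rearrange : ∀ u q → u + 2 * q * u ≡ u * suc (2 * q)
          rearrange = solve-∀
        d∣uM : d ∣ u * M
        d∣uM = ∣n⇒∣m*n u d∣M
        x→0 : Ar x (zeroZ q)
        x→0 = InJ⇒Ar x (zeroZ q) (≈-trans (+-≈ (≈-refl {u}) (toℕ-mod≈ _)) (≈-trans (≡⇒≈ u+x≡uM) (k*M≈0 u)))
              u∈J
        x∉K : x ∉ K
        x∉K x∈K = u≢0 (n∣m⇒m%n≡0 u d (∣m+n∣m⇒∣n (subst (d ∣_) (trans (sym u+x≡uM) (+-comm u _)) d∣uM)
                                                      (InK⇒∣ (2 * q * u) x∈K)))
        z∈K : z ∈ K
        z∈K = ∣⇒InK (v + 2 * q * u) (m%n≡0⇒n∣m _ d (trans (Mod-d.un≈ v-u≈0) Mod-d.0%M))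
          where
          v-u≈0 : v + 2 * q * u Mod-d.≈ 0
          v-u≈0 = Mod-d.≈-trans (Mod-d.+-≈ (Mod-d.mk≈ (sym u≡v)) Mod-d.≈-refl)
                  (Mod-d.≈-trans (Mod-d.≡⇒≈ u+x≡uM) (Mod-d.mk≈ (trans (n∣m⇒m%n≡0 _ d d∣uM) (sym Mod-d.0%M))))

      splitting : Splitting
      splitting with odd-factorisation d (M / d) q (m*[n/m]≡n d∣M) 1<d d<M
      ... | factors , d≡2a+1 = record { factors = factors ; periodic = Periodic-cong d≡2a+1 periodic }

  subgroup⇒splitting : ∀ K → Module K → Big K → Proper K → zeroZ q ∈ K →
                       (∀ g x → g ∈ K → x ∈ K → τ g x ∈ K) → Splitting
  subgroup⇒splitting K mK bK pK 0∈K closed with Subgroup.least-positive K 0∈K closed bK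
  ... | d , d<M , (0<d , d∈K) , minimal = Subgroup.Generator.splitting K 0∈K closed mK pK d d<M 0<d d∈K minimal

  nontrivial⇒splitting : Σ (Subset M) Nontrivial → Splitting
  nontrivial⇒splitting (K , mK , bK@(y , _ , y∈K , _) , pK) =
    from-maximal (extend-to-maximal (shift y K) (shift-module y K mK) (shift-proper y K pK))
    where
    0∈shift : zeroZ q ∈ shift y K
    0∈shift = ∈-preimage⁺ (τ y) K (zeroZ q) (subst (_∈ K) (sym (τ-zero y)) y∈K)
    from-maximal : (Σ (Subset M) λ K' → Module K' × Proper K' × shift y K ⊆ K' × Maximal K') → Splitting
    from-maximal (K' , mK' , pK' , K⊆K' , maxK') =
      subgroup⇒splitting K' mK' (enlarge (shift-big y K bK)) pK' (K⊆K' 0∈shift)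
                         (maximal-translation-closed K' mK' pK' (K⊆K' 0∈shift) maxK')
      where
      enlarge : Big (shift y K) → Big K'
      enlarge (a , b , a∈ , b∈ , a≢b) = a , b , K⊆K' a∈ , K⊆K' b∈ , a≢b

-- Given a splitting M = dA·eB (dA = 2a+1, eB = 2b+1) along which J is periodic,
-- Circ q J ≅ A[B]: x ↦ (x mod dA, x div dA), where A is the circulant on ℤ_dA
-- induced by J and B the circulant on ℤ_eB with symbols {k ∣ dA·k ∈ J}.
module Split (q : ℕ) (J : Subset (suc (2 * q))) (ax : OneOfEachPair q J)
             (S : Periodicity.Splitting q J ax) where
  open Periodicity q J ax
  open Splitting S
  open OddFactorisation factors

  dA eB : ℕ
  dA = suc (2 * a)
  eB = suc (2 * b)

  module ModA = Congruence dA
  module ResA = Residues a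
  module ModB = Congruence eB
  module ResB = Residues b

  M≡eB*dA : M ≡ eB * dA
  M≡eB*dA = trans (sym product) (*-comm dA eB)

  ≈⇒≈A : ∀ {u v} → u ≈ v → u ModA.≈ v
  ≈⇒≈A = ≈-divisor (divides eB M≡eB*dA)

  dA*k≈A0 : ∀ k → dA * k ModA.≈ 0
  dA*k≈A0 k = ModA.≈-trans (ModA.≡⇒≈ (*-comm dA k)) (ModA.k*M≈0 k)

  negA≈ : ∀ (r : Fin dA) → toℕ (negZ a r) ModA.≈ neg (toℕ r)
  negA≈ r = ModA.+-cancelʳ-≈ {c = toℕ r} (ModA.≈-trans (ResA.negZ-+ r)
              (ModA.≈-sym (≈⇒≈A (≈-trans (≡⇒≈ (+-comm (neg (toℕ r)) (toℕ r))) (neg+ (toℕ r))))))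

  dA≤M : dA ≤ M
  dA≤M = subst (dA ≤_) product (m≤m*n dA eB)

  residueA≢0 : ∀ (r : Fin dA) → toℕ r ≢ 0 → toℕ r % dA ≢ 0
  residueA≢0 r r≢0 e = r≢0 (trans (sym (m<n⇒m%n≡m (toℕ<n r))) e)

  negA≢0 : ∀ (r : Fin dA) → toℕ r ≢ 0 → toℕ (negZ a r) % dA ≢ 0
  negA≢0 r r≢0 = residueA≢0 (negZ a r) λ -r≡0 → r≢0 (cong toℕ (begin
    r                     ≡⟨ ResA.negZ-involutive r ⟨
    negZ a (negZ a r)     ≡⟨ cong (negZ a) (toℕ-injective -r≡0) ⟩
    negZ a (zeroZ a)      ≡⟨ ResA.negZ-zero ⟩
    zeroZ a               ∎))
    where open ≡-Reasoning

  inA : Fin dA → Fin M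
  inA r = toℕ r mod M

  JA : Subset dA
  JA = preimage inA J

  JA-axioms : OneOfEachPair a JA
  JA-axioms = record { zero∉ = zero∉ ; not-both = not-both ; one-of = one-of }
    where
    zero∉ : zeroZ a ∉ JA
    zero∉ h = InJ-zero ≈-refl (∈-preimage⁻ inA J _ h)
    not-both : ∀ r → r ∈ JA → negZ a r ∉ JA
    not-both r r∈ -r∈ with toℕ r ≟ 0
    ... | yes r≡0 = InJ-zero (≡⇒≈ r≡0) (∈-preimage⁻ inA J r r∈)
    ... | no  r≢0 = InJ-not-both (toℕ r) (neg (toℕ r)) (neg+ (toℕ r)) (∈-preimage⁻ inA J r r∈)
                      (periodic (toℕ (negZ a r)) (neg (toℕ r)) (ModA.un≈ (negA≈ r)) (negA≢0 r r≢0)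
                                (∈-preimage⁻ inA J (negZ a r) -r∈))
    one-of : ∀ r → r ≢ zeroZ a → r ∈ JA ⊎ negZ a r ∈ JA
    one-of r r≢0 = by-cases (InJ-one-of (toℕ r) (neg (toℕ r)) (neg+ (toℕ r))
                               (λ r≈0 → toℕr≢0 (residue-≡0 (<-≤-trans (toℕ<n r) dA≤M) r≈0)))
      where
      toℕr≢0 : toℕ r ≢ 0
      toℕr≢0 e = r≢0 (toℕ-injective e)
      by-cases : InJ (toℕ r) ⊎ InJ (neg (toℕ r)) → r ∈ JA ⊎ negZ a r ∈ JA
      by-cases (inj₁ r∈J)  = inj₁ (∈-preimage⁺ inA J r r∈J)
      by-cases (inj₂ -r∈J) = inj₂ (∈-preimage⁺ inA J (negZ a r)
        (periodic (neg (toℕ r)) (toℕ (negZ a r)) (sym (ModA.un≈ (negA≈ r)))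
                  (λ e → negA≢0 r toℕr≢0 (trans (ModA.un≈ (negA≈ r)) e)) -r∈J))

  inB : Fin eB → Fin M
  inB k = (dA * toℕ k) mod M

  JB : Subset eB
  JB = preimage inB J

  dA*k<M : ∀ (k : Fin eB) → dA * toℕ k < M
  dA*k<M k = subst (dA * toℕ k <_) product (*-monoʳ-< dA (toℕ<n k))

  dA*negZ : ∀ (k : Fin eB) → dA * toℕ k + dA * toℕ (negZ b k) ≈ 0
  dA*negZ k = begin
    dA * toℕ k + dA * toℕ (negZ b k)   ≡⟨ *-distribˡ-+ dA (toℕ k) _ ⟨
    dA * (toℕ k + toℕ (negZ b k))      ≈⟨ ≈-scale M≡eB*dA
                                            (ModB.≈-trans (ModB.≡⇒≈ (+-comm (toℕ k) _)) (ResB.negZ-+ k)) ⟩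
    dA * 0                             ≡⟨ *-zeroʳ dA ⟩
    0                                  ∎
    where open ≈-Reasoning

  JB-axioms : OneOfEachPair b JB
  JB-axioms = record { zero∉ = zero∉ ; not-both = not-both ; one-of = one-of }
    where
    zero∉ : zeroZ b ∉ JB
    zero∉ h = InJ-zero (≡⇒≈ (*-zeroʳ dA)) (∈-preimage⁻ inB J _ h)
    not-both : ∀ k → k ∈ JB → negZ b k ∉ JB
    not-both k k∈ -k∈ = InJ-not-both (dA * toℕ k) (dA * toℕ (negZ b k)) (dA*negZ k)
                          (∈-preimage⁻ inB J k k∈) (∈-preimage⁻ inB J (negZ b k) -k∈)
    one-of : ∀ k → k ≢ zeroZ b → k ∈ JB ⊎ negZ b k ∈ JB
    one-of k k≢0 with InJ-one-of (dA * toℕ k) (dA * toℕ (negZ b k)) (dA*negZ k) dA*k≉0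
      where
      dA*k≉0 : ¬ (dA * toℕ k ≈ 0)
      dA*k≉0 e with m*n≡0⇒m≡0∨n≡0 dA (residue-≡0 (dA*k<M k) e)
      ... | inj₂ k≡0 = k≢0 (toℕ-injective k≡0)
    ... | inj₁ k∈J  = inj₁ (∈-preimage⁺ inB J _ k∈J)
    ... | inj₂ -k∈J = inj₂ (∈-preimage⁺ inB J _ -k∈J)

  A B : CircTournament
  A = record { q = a ; q≥1 = 1≤a ; J = JA ; symbol = axioms⇒symbol JA-axioms }
  B = record { q = b ; q≥1 = 1≤b ; J = JB ; symbol = axioms⇒symbol JB-axioms }

  -- Vertex (r , k) of A[B] is the residue r + dA·k of ℤ_M.
  pair : Fin dA × Fin eB → Fin M
  pair (r , k) = cast (sym M≡eB*dA) (combine k r)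

  unpair : Fin M → Fin dA × Fin eB
  unpair x = swap (remQuot dA (cast M≡eB*dA x))

  pair∘unpair : ∀ x → pair (unpair x) ≡ x
  pair∘unpair x = trans (cong (cast (sym M≡eB*dA)) (combine-remQuot {eB} dA (cast M≡eB*dA x)))
                        (cast-involutive (sym M≡eB*dA) M≡eB*dA x)

  unpair∘pair : ∀ p → unpair (pair p) ≡ p
  unpair∘pair (r , k) = cong swap (trans
    (cong (remQuot dA) (cast-involutive M≡eB*dA (sym M≡eB*dA) (combine k r))) (remQuot-combine k r))

  toℕ-pair : ∀ r k → toℕ (pair (r , k)) ≡ dA * toℕ k + toℕ r
  toℕ-pair r k = trans (toℕ-cast (sym M≡eB*dA) (combine k r)) (toℕ-combine k r)

  same-block : ∀ r k k' → dA * toℕ (subZ b k' k) + toℕ (pair (r , k)) ≈ toℕ (pair (r , k'))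
  same-block r k k' = begin
    dA * s + toℕ (pair (r , k))      ≡⟨ cong (dA * s +_) (toℕ-pair r k) ⟩
    dA * s + (dA * toℕ k + toℕ r)    ≡⟨ rearrange dA s (toℕ k) (toℕ r) ⟩
    dA * (s + toℕ k) + toℕ r         ≈⟨ +-≈ (≈-scale M≡eB*dA (ResB.subZ-+ k' k)) ≈-refl ⟩
    dA * toℕ k' + toℕ r              ≡⟨ toℕ-pair r k' ⟨
    toℕ (pair (r , k'))              ∎
    where
    open ≈-Reasoning
    s : ℕ
    s = toℕ (subZ b k' k)
    rearrange : ∀ d s k r → d * s + (d * k + r) ≡ d * (s + k) + r
    rearrange = solve-∀

  pair≈A : ∀ r k → toℕ (pair (r , k)) ModA.≈ toℕ r
  pair≈A r k = ModA.≈-trans (ModA.≡⇒≈ (toℕ-pair r k)) (ModA.+-≈ (dA*k≈A0 (toℕ k)) ModA.≈-refl)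

  cross-block : ∀ r r' k k' → toℕ (subZ a r' r) ModA.≈ diff (pair (r , k)) (pair (r' , k'))
  cross-block r r' k k' = ModA.+-cancelʳ-≈ {c = toℕ r} (begin
    toℕ (subZ a r' r) + toℕ r        ≈⟨ ResA.subZ-+ r' r ⟩
    toℕ r'                           ≈⟨ pair≈A r' k' ⟨
    toℕ Y                            ≈⟨ ≈⇒≈A (diff-+ X Y) ⟨
    diff X Y + toℕ X                 ≈⟨ ModA.+-≈ (ModA.≈-refl {diff X Y}) (pair≈A r k) ⟩
    diff X Y + toℕ r                 ∎)
    where
    open ModA.≈-Reasoning
    X Y : Fin M
    X = pair (r , k)
    Y = pair (r' , k')

  cross-nonzero : ∀ r r' → r ≢ r' → toℕ (subZ a r' r) % dA ≢ 0
  cross-nonzero r r' r≢r' t%dA≡0 = r≢r' (ModA.Fin-≈ (ModA.≈-trans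
    (ModA.≈-sym (ModA.+-≈ (ModA.mk≈ (trans t%dA≡0 (sym ModA.0%M))) (ModA.≈-refl {toℕ r})))
    (ResA.subZ-+ r' r)))

  cross-arc : ∀ r r' k k' → r ≢ r' → InJ (toℕ (subZ a r' r)) → Ar (pair (r , k)) (pair (r' , k'))
  cross-arc r r' k k' r≢r' =
    periodic (toℕ (subZ a r' r)) (diff (pair (r , k)) (pair (r' , k')))
             (ModA.un≈ (cross-block r r' k k')) (cross-nonzero r r' r≢r')

  cross-arc⁻ : ∀ r r' k k' → r ≢ r' → Ar (pair (r , k)) (pair (r' , k')) → InJ (toℕ (subZ a r' r))
  cross-arc⁻ r r' k k' r≢r' =
    periodic (diff (pair (r , k)) (pair (r' , k'))) (toℕ (subZ a r' r))
             (sym (ModA.un≈ (cross-block r r' k k')))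
             (λ e → cross-nonzero r r' r≢r' (trans (ModA.un≈ (cross-block r r' k k')) e))

  pair-arc : ∀ p p' → Arc (toDigraph A [ toDigraph B ]) p p' → Ar (pair p) (pair p')
  pair-arc (r , k) (r' , k') (inj₁ (refl , k→k')) =
    InJ⇒Ar (pair (r , k)) (pair (r , k')) (same-block r k k') (∈-preimage⁻ inB J (subZ b k' k) k→k')
  pair-arc (r , k) (r' , k') (inj₂ (r≢r' , r→r')) =
    cross-arc r r' k k' r≢r' (∈-preimage⁻ inA J (subZ a r' r) r→r')

  pair-arc⁻ : ∀ p p' → Ar (pair p) (pair p') → Arc (toDigraph A [ toDigraph B ]) p p'
  pair-arc⁻ (r , k) (r' , k') X→Y with r ≟F r'
  ... | yes refl = inj₁ (refl , ∈-preimage⁺ inB J (subZ b k' k)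
                                  (Ar⇒InJ (pair (r , k)) (pair (r , k')) (same-block r k k') X→Y))
  ... | no r≢r'  = inj₂ (r≢r' , ∈-preimage⁺ inA J (subZ a r' r) (cross-arc⁻ r r' k k' r≢r' X→Y))

  split : Circ q J ≅ (toDigraph A [ toDigraph B ])
  split = ≅-sym {toDigraph A [ toDigraph B ]} {Circ q J}
    (mkIso {toDigraph A [ toDigraph B ]} {Circ q J} pair unpair pair∘unpair unpair∘pair
           pair-arc pair-arc⁻)

module _ (q : ℕ) (J : Subset (suc (2 * q))) (ax : OneOfEachPair q J) where
  open Modules q J ax

  -- Membership is decided in Fin M: x lies in the copy of v₀
  -- iff its representative, the vertex (block x , y₀), is (v₀ , y₀).
  composition⇒module : ∀ {D F} → HasTwoVertices D → HasTwoVertices F → Circ q J ≅ (D [ F ]) →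
                       Σ (Subset M) Nontrivial
  composition⇒module {D} {F} (v₀ , v₁ , v₀≢v₁) (y₀ , y₁ , y₀≢y₁) i = K , mK , bK , pK
    where
    open Iso {Circ q J} {D [ F ]} i
    block : Fin M → V D
    block x = proj₁ (to x)
    block-from : ∀ v y → block (from (v , y)) ≡ v
    block-from v y = cong proj₁ (to∘from (v , y))
    representative : Fin M → Fin M
    representative x = from (block x , y₀)
    K : Subset M
    K = preimage representative ⁅ from (v₀ , y₀) ⁆
    ∈K⇒ : ∀ {x} → x ∈ K → block x ≡ v₀
    ∈K⇒ {x} x∈K = cong proj₁ (from-injective (block x , y₀) (v₀ , y₀)
      (x∈⁅y⁆⇒x≡y (from (v₀ , y₀)) (∈-preimage⁻ representative ⁅ from (v₀ , y₀) ⁆ x x∈K)))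
    ⇒∈K : ∀ {x} → block x ≡ v₀ → x ∈ K
    ⇒∈K {x} e = ∈-preimage⁺ representative ⁅ from (v₀ , y₀) ⁆ x
                  (subst (λ v → from (v , y₀) ∈ ⁅ from (v₀ , y₀) ⁆) (sym e) (x∈⁅x⁆ (from (v₀ , y₀))))
    mK : Module K
    mK x y z x∉K y∈K z∈K = into , out-of
      where
      same : block y ≡ block z
      same = trans (∈K⇒ y∈K) (sym (∈K⇒ z∈K))
      into : Ar x y → Ar x z
      into x→y with arc x y x→y
      ... | inj₁ (e , _)     = contradiction (⇒∈K (trans e (∈K⇒ y∈K))) x∉K
      ... | inj₂ (ne , x→y') = arc⁻ x z (inj₂ ((λ e → ne (trans e (sym same))) ,
                                               subst (Arc D (block x)) same x→y'))
      out-of : Ar y x → Ar z x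
      out-of y→x with arc y x y→x
      ... | inj₁ (e , _)     = contradiction (⇒∈K (trans (sym e) (∈K⇒ y∈K))) x∉K
      ... | inj₂ (ne , y→x') = arc⁻ z x (inj₂ ((λ e → ne (trans same e)) ,
                                               subst (λ w → Arc D w (block x)) same y→x'))
    bK : Big K
    bK = from (v₀ , y₀) , from (v₀ , y₁) , ⇒∈K (block-from v₀ y₀) , ⇒∈K (block-from v₀ y₁) ,
         λ e → y₀≢y₁ (cong proj₂ (from-injective (v₀ , y₀) (v₀ , y₁) e))
    pK : Proper K
    pK = from (v₁ , y₀) , λ h → v₀≢v₁ (trans (sym (∈K⇒ h)) (block-from v₁ y₀))

  no-module⇒simple : ¬ (Σ (Subset M) Nontrivial) → Simple (Circ q J)
  no-module⇒simple none (D , F , twoD , twoF , i) = none (composition⇒module {D} {F} twoD twoF i)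

Decomposition : (q : ℕ) → Subset (suc (2 * q)) → Set₁
Decomposition q J = Σ CircTournament λ T₁ → Σ (List CircTournament) λ Ts →
                    AllSimple (T₁ ∷ Ts) × (Circ q J ≅ nest T₁ Ts)

compose-decompositions : ∀ {q J} (A B : CircTournament) → Circ q J ≅ (toDigraph A [ toDigraph B ]) →
  Decomposition (CircTournament.q A) (CircTournament.J A) →
  Decomposition (CircTournament.q B) (CircTournament.J B) → Decomposition q J
compose-decompositions {q} {J} A B i (A₁ , As , sA , iA) (B₁ , Bs , sB , iB) =
  A₁ , As ++ B₁ ∷ Bs , AllSimple-++ A₁ As B₁ Bs sA sB ,
  ≅-trans {Circ q J} {toDigraph A [ toDigraph B ]} {nest A₁ (As ++ B₁ ∷ Bs)} i
    (≅-trans {toDigraph A [ toDigraph B ]} {nest A₁ As [ nest B₁ Bs ]} {nest A₁ (As ++ B₁ ∷ Bs)}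
      ([]-cong {toDigraph A} {nest A₁ As} {toDigraph B} {nest B₁ Bs} iA iB) (nest-++ A₁ As B₁ Bs))

decompose : ∀ q → 1 ≤ q → (J : Subset (suc (2 * q))) → IsSymbolSet q J → Decomposition q J
decompose = <-rec Decomposable step
  where
  Decomposable : ℕ → Set₁
  Decomposable q = 1 ≤ q → (J : Subset (suc (2 * q))) → IsSymbolSet q J → Decomposition q J
  step : ∀ q → (∀ {p} → p < q → Decomposable p) → Decomposable q
  step q rec 1≤q J symbol = by-cases (anySubset? (Modules.Nontrivial? q J ax))
    where
    ax : OneOfEachPair q J
    ax = symbol⇒axioms symbol
    from-splitting : Periodicity.Splitting q J ax → Decomposition q J
    from-splitting S = compose-decompositions {q} {J} A B split
      (rec a<q (CircTournament.q≥1 A) (CircTournament.J A) (CircTournament.symbol A))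
      (rec b<q (CircTournament.q≥1 B) (CircTournament.J B) (CircTournament.symbol B))
      where
      open Split q J ax S using (A; B; split)
      open OddFactorisation (Periodicity.Splitting.factors S)
    by-cases : Dec (Σ (Subset (suc (2 * q))) (Modules.Nontrivial q J ax)) → Decomposition q J
    by-cases (no none) = record { q = q ; q≥1 = 1≤q ; J = J ; symbol = symbol } , [] ,
                         (no-module⇒simple q J ax none , tt) , ≅-refl {Circ q J}
    by-cases (yes nontrivial) = from-splitting (Periodicity.nontrivial⇒splitting q J ax nontrivial)

-- Theorem 7.
mainTheorem7 : (n : ℕ) → 1 ≤ n → (J : Subset (suc (2 * n))) → IsSymbolSet n J →
    Σ CircTournament (λ A → Σ CircTournament λ B → Circ n J ≅ (toDigraph A [ toDigraph B ])) →
    Σ CircTournament (λ T₁ → Σ (List CircTournament) λ Ts →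
      AllSimple (T₁ ∷ Ts) × (Circ n J ≅ nest T₁ Ts))
mainTheorem7 n 1≤n J symbol _ = decompose n 1≤n J symbol
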